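{- Let $n$ and $k$ be integers with $k \geq 3$ and $k > n/2$, and let $H$ be the complete $k$-uniform hypergraph on the vertex set $[n]=\{1,\dots,n\}$ (its hyperedges are all $k$-element subsets of $[n]$). Then the coloring complex $\Lambda(H)$ is shellable and has dimension $n-k-1$.
   Context: For a hypergraph $H$ on $[n]$, an $r$-face of the coloring complex $\Lambda(H)$ is an ordered set partition $(B_1,\dots,B_{r+2})$ of $[n]$ into nonempty blocks such that at least one block $B_i$ contains a hyperedge of $H$. Equivalently, identifying $(B_1,\dots,B_{r+2})$ with the chain $\emptyset \subsetneq S_1 \subsetneq \dots \subsetneq S_{r+1} \subsetneq [n]$, $S_i = B_1\cup\dots\cup B_i$, $\Lambda(H)$ is the simplicial complex whose vertices are proper nonempty subsets of $[n]$ and whose faces are such chains for which some difference $S_i\setminus S_{i-1}$ ($S_0=\emptyset$, $S_{r+2}=[n]$) contains a hyperedge; the faces of a face are obtained by merging consecutive blocks. A complex is shellable if its facets can be ordered $F_1,\dots,F_m$ so that for each $l\ge 2$, $(\bigcup_{i<l}\overline{F_i})\cap \overline{F_l}$ is pure of dimension $\dim F_l - 1$, where $\overline{F}$ denotes the set of all faces of $F$. -}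

module Defs where

open import Data.Nat using (ℕ)
open import Data.Integer using (ℤ; +_; _-_; _≤_)
open import Data.Fin.Subset using (Subset; ⊥; ⊤; _⊆_; _⊂_; _─_; ∣_∣)
open import Data.List using (List; []; _∷_; _∷ʳ_; length; _++_)
open import Data.List.Relation.Unary.Linked using (Linked)
open import Data.List.Relation.Unary.All using (All)
open import Data.List.Relation.Unary.Unique.Propositional using (Unique)
open import Data.List.Membership.Propositional using (_∈_)
open import Data.List.Relation.Binary.Sublist.Propositional using () renaming (_⊆_ to _⊑_)
open import Data.Product using (Σ; ∃; _×_)
open import Relation.Binary.PropositionalEquality using (_≡_)

Hypergraph : ℕ → Set₁
Hypergraph n = Subset n → Set

Complete : (n k : ℕ) → Hypergraph n
Complete n k e = ∣ e ∣ ≡ k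

data AnyAdj {A : Set} (R : A → A → Set) : List A → Set where
  here  : ∀ {x y xs} → R x y → AnyAdj R (x ∷ y ∷ xs)
  there : ∀ {x xs} → AnyAdj R xs → AnyAdj R (x ∷ xs)

-- A (candidate) face is a chain S₁ ⊊ … ⊊ S_{r+1}, stored as the increasing list
-- [S₁, …, S_{r+1}]; its augmentation is ∅ ∷ S₁ ∷ … ∷ S_{r+1} ∷ [n].
augment : ∀ {n} → List (Subset n) → List (Subset n)
augment S = (⊥ ∷ S) ∷ʳ ⊤

BlockHasEdge : ∀ {n} → Hypergraph n → Subset n → Subset n → Set
BlockHasEdge H A B = ∃ λ e → H e × (e ⊆ B ─ A)

Λ : ∀ {n} → Hypergraph n → List (Subset n) → Set
Λ H S = Linked _⊂_ (augment S) × AnyAdj (BlockHasEdge H) (augment S)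

Complex : ℕ → Set₁
Complex n = List (Subset n) → Set

dim : ∀ {n} → List (Subset n) → ℤ
dim F = + length F - + 1

-- faces of the simplex F̄: all subchains (sub-lists) of F
-- (merging consecutive blocks = deleting elements of the chain)

IsFacet : ∀ {n} → Complex n → List (Subset n) → Set
IsFacet K F = K F × (∀ G → K G → F ⊑ G → G ≡ F)

HasDimension : ∀ {n} → Complex n → ℤ → Set
HasDimension K d = (∃ λ G → K G × dim G ≡ d) × (∀ G → K G → dim G ≤ d)

PureOfDim : ∀ {n} → Complex n → ℤ → Set
PureOfDim K d = (∀ G → K G → ∃ λ G' → K G' × G ⊑ G' × dim G' ≡ d)
              × (∀ G → K G → dim G ≤ d)

EarlierIntersection : ∀ {n} → List (List (Subset n)) → List (Subset n) → Complex n
EarlierIntersection pre F G = G ⊑ F × ∃ λ F' → F' ∈ pre × G ⊑ F'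

-- A shelling: an ordering Fs = F₁,…,F_m of all facets of K (each exactly once)
-- such that for l ≥ 2, (⋃_{i<l} F̄ᵢ) ∩ F̄_l is pure of dimension dim F_l - 1.
Shellable : ∀ {n} → Complex n → Set
Shellable {n} K = ∃ λ (Fs : List (List (Subset n))) →
    All (IsFacet K) Fs × Unique Fs × (∀ F → IsFacet K F → F ∈ Fs)
  × (∀ (pre post : List (List (Subset n))) (F : List (Subset n)) (F₀ : List (Subset n)) →
       Fs ≡ (F₀ ∷ pre) ++ (F ∷ post) →
       PureOfDim (EarlierIntersection (F₀ ∷ pre) F) (dim F - + 1))

-- For the complete k-uniform hypergraph a block contains a hyperedge iff it has at least k
-- elements, so Λ(H) is the complex of chains ∅ ⊂ S₁ ⊂ … ⊂ [n] with some step of size ≥ k.  Such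
-- a chain has at most n − k vertices and a shorter one can be refined, so the facets are the
-- chains with n − k vertices.  They are shelled in lexicographic order, subsets being compared
-- as characteristic vectors.  If F′ precedes F, first differing at T′ ≺ T, then F has a vertex
-- B ∉ F′ with a descent: B can be replaced by A ∪ {z}, for its neighbours A ⊂ B ⊂ C and some
-- z ∈ C ∖ A, giving an earlier facet containing F ∖ {B}.  When T′ ⊆ T this vertex is T: it
-- cannot occur later in F′, because splicing F′ below T with F above T would give a face with
-- more than n − k vertices, unless their large steps lay on opposite sides of T, which needs
-- 2k ≤ n.  Otherwise take y ∈ T′ ∖ T and walk up F from T: at a vertex without a descent the
-- step is a single element below y and all elements added later are smaller still, so y is
-- never added and the walk stops at a descent before reaching [n].

module Submission where

open import Data.Bool.Base using (f<t) renaming (_<_ to _<ᴮ_)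
open import Data.Fin.Base as Fin using (Fin; zero; suc)
import Data.Fin.Properties as Finₚ
open import Data.Fin.Subset hiding (_-_)
open import Data.Fin.Subset.Properties
open import Data.Integer.Base as ℤ using (+_; _-_; +≤+)
import Data.Integer.Properties as ℤₚ
import Data.List.Base as List
open import Data.List.Base
  using (List; []; _∷_; _++_; _∷ʳ_; [_]; length; map; filter; cartesianProductWith)
import Data.List.Properties as Listₚ
open import Data.List.Membership.Propositional using () renaming (_∈_ to _∈ₗ_; _∉_ to _∉ₗ_)
open import Data.List.Membership.Propositional.Properties
  using (∈-++⁺ˡ; ∈-++⁺ʳ; ∈-++⁻; ∈-map⁻; ∈-∃++; ∈-filter⁺; ∈-filter⁻
        ; ∈-cartesianProductWith⁺; ∈-cartesianProductWith⁻)
open import Data.List.Relation.Binary.Equality.Propositional using (≋⇒≡)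
open import Data.List.Relation.Binary.Sublist.Propositional using ([]; _∷_; lookup)
  renaming (_⊆_ to _⊑_; _∷ʳ_ to skip; ⊆-refl to ⊑-refl)
open import Data.List.Relation.Binary.Sublist.Propositional.Properties using (length-mono-≤; to-≋)
open import Data.List.Relation.Unary.All using (All; []; _∷_)
import Data.List.Relation.Unary.All as All
open import Data.List.Relation.Unary.AllPairs using (AllPairs; []; _∷_)
import Data.List.Relation.Unary.AllPairs as AllPairs
import Data.List.Relation.Unary.AllPairs.Properties as AllPairsₚ
open import Data.List.Relation.Unary.Any using (here; there)
open import Data.List.Relation.Unary.Linked using (Linked; []; [-]; _∷_; tail; linked?)
open import Data.List.Relation.Unary.Linked.Properties using (Linked⇒All)
open import Data.Nat.Base using (ℕ; zero; suc; _+_; _*_; _∸_; _≤_; _<_; s≤s; z≤n)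
open import Data.Nat.Properties using (_<?_; _≤?_; module ≤-Reasoning)
import Data.Nat.Properties as ℕₚ
open import Data.Product using (∃; ∃₂; _×_; _,_; proj₁; proj₂)
open import Data.Sum using (_⊎_; inj₁; inj₂)
import Data.Sum as Sum
open import Data.Vec.Base using ([]; _∷_; here; there)
import Data.Vec.Base as Vec
open import Function.Base using (_∘_)
open import Function.Bundles using (_⇔_; mk⇔; Equivalence)
import Function.Properties.Equivalence as ⇔
open import Level using (0ℓ)
open import Relation.Binary.Core using (Rel)
open import Relation.Binary.Definitions using (Decidable; Transitive; tri<; tri≈; tri>)
open import Relation.Binary.PropositionalEquality hiding ([_])
open import Relation.Nullary using (¬_; Dec; yes; no; contradiction)
open import Relation.Nullary.Decidable using (_×-dec_; ¬?; map′; decidable-stable)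

open import Defs

private variable
  n : ℕ
  p q A B C : Subset n
  K K′ : Complex n
  x y z : Fin n

∣p─q∣+∣q∣≡∣p∣ : ∀ {n} {p q : Subset n} → q ⊆ p → ∣ p ─ q ∣ + ∣ q ∣ ≡ ∣ p ∣
∣p─q∣+∣q∣≡∣p∣ {p = []} {q = []} _ = refl
∣p─q∣+∣q∣≡∣p∣ {p = outside ∷ p} {q = outside ∷ q} q⊆p = ∣p─q∣+∣q∣≡∣p∣ (drop-∷-⊆ q⊆p)
∣p─q∣+∣q∣≡∣p∣ {p = inside ∷ p} {q = outside ∷ q} q⊆p = cong suc (∣p─q∣+∣q∣≡∣p∣ (drop-∷-⊆ q⊆p))
∣p─q∣+∣q∣≡∣p∣ {p = outside ∷ p} {q = inside ∷ q} q⊆p = contradiction (q⊆p here) λ ()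
∣p─q∣+∣q∣≡∣p∣ {p = inside ∷ p} {q = inside ∷ q} q⊆p =
  trans (ℕₚ.+-suc _ _) (cong suc (∣p─q∣+∣q∣≡∣p∣ (drop-∷-⊆ q⊆p)))

∃-⊆-of-size : ∀ {n} {p : Subset n} k → k ≤ ∣ p ∣ → ∃ λ e → e ⊆ p × ∣ e ∣ ≡ k
∃-⊆-of-size {n} zero _ = ⊥ , (λ x∈⊥ → contradiction x∈⊥ ∉⊥) , ∣⊥∣≡0 n
∃-⊆-of-size {p = inside ∷ p} (suc k) (s≤s k≤∣p∣) with ∃-⊆-of-size k k≤∣p∣
... | e , e⊆p , ∣e∣≡k = inside ∷ e , in⊆in e⊆p , cong suc ∣e∣≡k
∃-⊆-of-size {p = outside ∷ p} (suc k) k<∣p∣ with ∃-⊆-of-size (suc k) k<∣p∣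
... | e , e⊆p , ∣e∣≡k = outside ∷ e , out⊆ e⊆p , ∣e∣≡k

p⊆q∧∣p∣<∣q∣⇒p⊂q : p ⊆ q → ∣ p ∣ < ∣ q ∣ → p ⊂ q
p⊆q∧∣p∣<∣q∣⇒p⊂q p⊆q ∣p∣<∣q∣ = p⊆q , missing p⊆q ∣p∣<∣q∣
  where
  missing : ∀ {n} {p q : Subset n} → p ⊆ q → ∣ p ∣ < ∣ q ∣ → ∃ λ x → x ∈ q × x ∉ p
  missing {p = outside ∷ p} {q = inside ∷ q} _ _ = zero , here , λ ()
  missing {p = inside ∷ p} {q = outside ∷ q} p⊆q _ = contradiction (p⊆q here) λ ()
  missing {p = outside ∷ p} {q = outside ∷ q} p⊆q lt with missing (drop-∷-⊆ p⊆q) lt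
  ... | x , x∈q , x∉p = suc x , there x∈q , x∉p ∘ drop-there
  missing {p = inside ∷ p} {q = inside ∷ q} p⊆q (s≤s lt) with missing (drop-∷-⊆ p⊆q) lt
  ... | x , x∈q , x∉p = suc x , there x∈q , x∉p ∘ drop-there

x∈p∪⁅y⁆⁻ : x ∈ p ∪ ⁅ y ⁆ → x ∈ p ⊎ x ≡ y
x∈p∪⁅y⁆⁻ {p = p} {y} = Sum.map₂ (x∈⁅y⁆⇒x≡y y) ∘ x∈p∪q⁻ p ⁅ y ⁆

x∉p∪⁅y⁆ : x ∉ p → x ≢ y → x ∉ p ∪ ⁅ y ⁆
x∉p∪⁅y⁆ x∉p x≢y x∈ = Sum.[ x∉p , x≢y ] (x∈p∪⁅y⁆⁻ x∈)

p∪⁅x⁆⊆q : p ⊆ q → x ∈ q → p ∪ ⁅ x ⁆ ⊆ q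
p∪⁅x⁆⊆q p⊆q x∈q y∈ with x∈p∪⁅y⁆⁻ y∈
... | inj₁ y∈p = p⊆q y∈p
... | inj₂ refl = x∈q

p⊂p∪⁅x⁆ : x ∉ p → p ⊂ p ∪ ⁅ x ⁆
p⊂p∪⁅x⁆ {x = x} x∉p = p⊆p∪q ⁅ x ⁆ , x , x∈p∪q⁺ (inj₂ (x∈⁅x⁆ x)) , x∉p

∣p∪⁅x⁆∣≡1+∣p∣ : ∀ {n} {p : Subset n} {x} → x ∉ p → ∣ p ∪ ⁅ x ⁆ ∣ ≡ suc ∣ p ∣
∣p∪⁅x⁆∣≡1+∣p∣ {p = outside ∷ p} {x = zero} _ = cong (suc ∘ ∣_∣) (∪-identityʳ p)
∣p∪⁅x⁆∣≡1+∣p∣ {p = inside ∷ p} {x = zero} x∉p = contradiction here x∉p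
∣p∪⁅x⁆∣≡1+∣p∣ {p = outside ∷ p} {x = suc x} x∉p = ∣p∪⁅x⁆∣≡1+∣p∣ (x∉p ∘ there)
∣p∪⁅x⁆∣≡1+∣p∣ {p = inside ∷ p} {x = suc x} x∉p = cong suc (∣p∪⁅x⁆∣≡1+∣p∣ (x∉p ∘ there))

adjoin-⊂ : A ⊆ C → z ∈ C → z ∉ A → suc ∣ A ∣ < ∣ C ∣ → A ⊂ A ∪ ⁅ z ⁆ × A ∪ ⁅ z ⁆ ⊂ C
adjoin-⊂ {C = C} A⊆C z∈C z∉A gap =
  p⊂p∪⁅x⁆ z∉A ,
  p⊆q∧∣p∣<∣q∣⇒p⊂q (p∪⁅x⁆⊆q A⊆C z∈C) (subst (_< ∣ C ∣) (sym (∣p∪⁅x⁆∣≡1+∣p∣ z∉A)) gap)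

⊆⊎⊈ : ∀ (p q : Subset n) → p ⊆ q ⊎ ∃ λ x → x ∈ p × x ∉ q
⊆⊎⊈ p q with Finₚ.any? (λ x → x ∈? p ×-dec ¬? (x ∈? q))
... | yes witness = inj₂ witness
... | no none = inj₁ λ {x} x∈p → decidable-stable (x ∈? q) λ x∉q → none (x , x∈p , x∉q)

module _ {X : Set} where

  lastOr : X → List X → X
  lastOr x [] = x
  lastOr _ (y ∷ ys) = lastOr y ys

  lastOr-++ : ∀ x xs ys → lastOr x (xs ++ ys) ≡ lastOr (lastOr x xs) ys
  lastOr-++ x [] ys = refl
  lastOr-++ _ (y ∷ xs) ys = lastOr-++ y xs ys

  headOr : X → List X → X
  headOr x [] = x
  headOr _ (y ∷ _) = y

  neighbours : ∀ x P R (z : X) → ∃₂ λ L M →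
    ∀ B → (x ∷ P ++ B ∷ R) ∷ʳ z ≡ L ++ lastOr x P ∷ B ∷ headOr z R ∷ M
  neighbours x [] [] z = [] , [] , λ _ → refl
  neighbours x [] (r ∷ R) z = [] , R ∷ʳ z , λ _ → refl
  neighbours x (p ∷ P) R z with neighbours p P R z
  ... | L , M , eq = x ∷ L , M , cong (x ∷_) ∘ eq

module _ {X : Set} where

  ⊑-delete : ∀ (P : List X) {B R} → P ++ R ⊑ P ++ B ∷ R
  ⊑-delete [] = skip _ ⊑-refl
  ⊑-delete (x ∷ P) = refl ∷ ⊑-delete P

  ⊑-avoid : ∀ (P : List X) {B R G} → G ⊑ P ++ B ∷ R → B ∉ₗ G → G ⊑ P ++ R
  ⊑-avoid [] (skip _ G⊑R) _ = G⊑R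
  ⊑-avoid [] (refl ∷ _) B∉G = contradiction (here refl) B∉G
  ⊑-avoid (x ∷ P) (skip _ G⊑) B∉G = skip x (⊑-avoid P G⊑ B∉G)
  ⊑-avoid (x ∷ P) (refl ∷ G⊑) B∉G = refl ∷ ⊑-avoid P G⊑ (B∉G ∘ there)

  ⊑∧length≥⇒≡ : ∀ {xs ys : List X} → xs ⊑ ys → length ys ≤ length xs → xs ≡ ys
  ⊑∧length≥⇒≡ xs⊑ys ∣ys∣≤∣xs∣ = ≋⇒≡ (to-≋ (ℕₚ.≤-antisym (length-mono-≤ xs⊑ys) ∣ys∣≤∣xs∣) xs⊑ys)

  AllPairs-cartesianProductWith :
    ∀ {Y Z : Set} {R : Rel X 0ℓ} {S : Rel Y 0ℓ} {T : Rel Z 0ℓ} (f : X → Y → Z) →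
    (∀ {a a′ b b′} → R a a′ → T (f a b) (f a′ b′)) → (∀ {a b b′} → S b b′ → T (f a b) (f a b′)) →
    ∀ {xs ys} → AllPairs R xs → AllPairs S ys → AllPairs T (cartesianProductWith f xs ys)
  AllPairs-cartesianProductWith f R⇒T S⇒T [] _ = []
  AllPairs-cartesianProductWith {T = T} f R⇒T S⇒T {x ∷ xs} {ys} (x< ∷ sorted-xs) sorted-ys =
    AllPairsₚ.++⁺ (AllPairsₚ.map⁺ (AllPairs.map S⇒T sorted-ys))
                 (AllPairs-cartesianProductWith f R⇒T S⇒T sorted-xs sorted-ys)
                 (All.tabulate λ u∈ → All.tabulate λ v∈ → across u∈ v∈)
    where
    across : ∀ {u v} → u ∈ₗ map (f x) ys → v ∈ₗ cartesianProductWith f xs ys → T u v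
    across u∈ v∈ with ∈-map⁻ (f x) u∈ | ∈-cartesianProductWith⁻ f xs ys v∈
    ... | b , _ , refl | a′ , b′ , a′∈xs , _ , refl = R⇒T (All.lookup x< a′∈xs)

module _ {X : Set} {R : Rel X 0ℓ} where

  Linked-++⁻ : ∀ xs {y ys} → Linked R (xs ++ y ∷ ys) → Linked R (xs ∷ʳ y) × Linked R (y ∷ ys)
  Linked-++⁻ [] l = [-] , l
  Linked-++⁻ (x ∷ []) (r ∷ l) = r ∷ [-] , l
  Linked-++⁻ (x ∷ x′ ∷ xs) (r ∷ l) with Linked-++⁻ (x′ ∷ xs) l
  ... | l₁ , l₂ = r ∷ l₁ , l₂

  Linked-++⁺ : ∀ xs {y ys} → Linked R (xs ∷ʳ y) → Linked R (y ∷ ys) → Linked R (xs ++ y ∷ ys)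
  Linked-++⁺ [] _ l = l
  Linked-++⁺ (x ∷ []) (r ∷ [-]) l = r ∷ l
  Linked-++⁺ (x ∷ x′ ∷ xs) (r ∷ l₁) l₂ = r ∷ Linked-++⁺ (x′ ∷ xs) l₁ l₂

  Linked-neighbours : ∀ L {A B C M} → Linked R (L ++ A ∷ B ∷ C ∷ M) → R A B × R B C
  Linked-neighbours [] (r ∷ r′ ∷ _) = r , r′
  Linked-neighbours (x ∷ L) l = Linked-neighbours L (tail l)

  Linked-replace : ∀ L {A B C M w} → Linked R (L ++ A ∷ B ∷ C ∷ M) → R A w → R w C →
                   Linked R (L ++ A ∷ w ∷ C ∷ M)
  Linked-replace [] (_ ∷ _ ∷ l) r r′ = r ∷ r′ ∷ l
  Linked-replace (x ∷ []) (r ∷ l) = λ r₁ r₂ → r ∷ Linked-replace [] l r₁ r₂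
  Linked-replace (x ∷ x′ ∷ L) (r ∷ l) = λ r₁ r₂ → r ∷ Linked-replace (x′ ∷ L) l r₁ r₂

  ∈-init-Linked : Transitive R → ∀ xs {y v} → Linked R (xs ∷ʳ y) → v ∈ₗ xs → R v y
  ∈-init-Linked trans (x ∷ []) (r ∷ [-]) (here refl) = r
  ∈-init-Linked trans (x ∷ x′ ∷ xs) (r ∷ l) (here refl) =
    trans r (∈-init-Linked trans (x′ ∷ xs) l (here refl))
  ∈-init-Linked trans (x ∷ x′ ∷ xs) (r ∷ l) (there v∈) = ∈-init-Linked trans (x′ ∷ xs) l v∈

  ∈-tail-Linked : Transitive R → ∀ {y ys v} → Linked R (y ∷ ys) → v ∈ₗ ys → R y v
  ∈-tail-Linked trans (r ∷ l) = All.lookup (Linked⇒All trans r l)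

  AnyAdj-++⁻ : ∀ xs {y ys} → AnyAdj R (xs ++ y ∷ ys) → AnyAdj R (xs ∷ʳ y) ⊎ AnyAdj R (y ∷ ys)
  AnyAdj-++⁻ [] a = inj₂ a
  AnyAdj-++⁻ (x ∷ []) (here r) = inj₁ (here r)
  AnyAdj-++⁻ (x ∷ []) (there a) = inj₂ a
  AnyAdj-++⁻ (x ∷ x′ ∷ xs) (here r) = inj₁ (here r)
  AnyAdj-++⁻ (x ∷ x′ ∷ xs) (there a) = Sum.map₁ there (AnyAdj-++⁻ (x′ ∷ xs) a)

  AnyAdj-++⁺ˡ : ∀ xs {y ys} → AnyAdj R (xs ∷ʳ y) → AnyAdj R (xs ++ y ∷ ys)
  AnyAdj-++⁺ˡ [] (there ())
  AnyAdj-++⁺ˡ (x ∷ []) (here r) = here r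
  AnyAdj-++⁺ˡ (x ∷ []) (there (there ()))
  AnyAdj-++⁺ˡ (x ∷ x′ ∷ xs) (here r) = here r
  AnyAdj-++⁺ˡ (x ∷ x′ ∷ xs) (there a) = there (AnyAdj-++⁺ˡ (x′ ∷ xs) a)

  AnyAdj-++⁺ʳ : ∀ xs {y ys} → AnyAdj R (y ∷ ys) → AnyAdj R (xs ++ y ∷ ys)
  AnyAdj-++⁺ʳ [] a = a
  AnyAdj-++⁺ʳ (x ∷ xs) a = there (AnyAdj-++⁺ʳ xs a)

  AnyAdj-replace : ∀ L {A B C M w} → AnyAdj R (L ++ A ∷ B ∷ C ∷ M) → (R A B ⊎ R B C → R w C) →
                   AnyAdj R (L ++ A ∷ w ∷ C ∷ M)
  AnyAdj-replace [] (here r) f = there (here (f (inj₁ r)))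
  AnyAdj-replace [] (there (here r)) f = there (here (f (inj₂ r)))
  AnyAdj-replace [] (there (there a)) f = there (there a)
  AnyAdj-replace (x ∷ []) (here r) f = here r
  AnyAdj-replace (x ∷ []) (there a) f = there (AnyAdj-replace [] a f)
  AnyAdj-replace (x ∷ x′ ∷ L) (here r) f = here r
  AnyAdj-replace (x ∷ x′ ∷ L) (there a) f = there (AnyAdj-replace (x′ ∷ L) a f)

  AllPairs-++⁻ : ∀ xs {y ys} → AllPairs R (xs ++ y ∷ ys) →
                 (∀ {x} → x ∈ₗ xs → R x y) × (∀ {z} → z ∈ₗ ys → R y z)
  AllPairs-++⁻ [] (y< ∷ _) = (λ ()) , All.lookup y<
  AllPairs-++⁻ (x ∷ xs) (x< ∷ rest) =
    (λ { (here refl) → All.lookup x< (∈-++⁺ʳ xs (here refl))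
       ; (there x∈xs) → proj₁ (AllPairs-++⁻ xs rest) x∈xs }) ,
    proj₂ (AllPairs-++⁻ xs rest)

  anyAdj? : Decidable R → ∀ xs → Dec (AnyAdj R xs)
  anyAdj? R? [] = no λ ()
  anyAdj? R? (x ∷ []) = no λ { (there ()) }
  anyAdj? R? (x ∷ y ∷ xs) with R? x y | anyAdj? R? (y ∷ xs)
  ... | yes r | _ = yes (here r)
  ... | no _ | yes a = yes (there a)
  ... | no ¬r | no ¬a = no λ { (here r) → ¬r r ; (there a) → ¬a a }

  AnyAdj-map-Linked : ∀ {P Q : Rel X 0ℓ} → (∀ {x y} → R x y → P x y → Q x y) →
                      ∀ {xs} → Linked R xs → AnyAdj P xs → AnyAdj Q xs
  AnyAdj-map-Linked f (r ∷ l) (here p) = here (f r p)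
  AnyAdj-map-Linked f (r ∷ l) (there a) = there (AnyAdj-map-Linked f l a)

-- Chains with a wide step

Wide : ℕ → Subset n → Subset n → Set
Wide k A B = k + ∣ A ∣ ≤ ∣ B ∣

split-step : A ⊂ B → suc ∣ A ∣ < ∣ B ∣ → ∃ λ w → A ⊂ w × w ⊂ B × ∣ w ∣ ≡ suc ∣ A ∣
split-step (A⊆B , z , z∈B , z∉A) gap with adjoin-⊂ A⊆B z∈B z∉A gap
... | A⊂w , w⊂B = _ , A⊂w , w⊂B , ∣p∪⁅x⁆∣≡1+∣p∣ z∉A

split-wide-step : ∀ {k} → 1 ≤ k → A ⊂ B → k + ∣ A ∣ < ∣ B ∣ → ∃ λ w → A ⊂ w × w ⊂ B × Wide k w B
split-wide-step {A = A} {B} {k} 1≤k A⊂B gap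
  with split-step A⊂B (ℕₚ.≤-<-trans (ℕₚ.+-monoˡ-≤ ∣ A ∣ 1≤k) gap)
... | w , A⊂w , w⊂B , ∣w∣≡1+∣A∣ =
  w , A⊂w , w⊂B , subst (_≤ ∣ B ∣) (sym (trans (cong (_+_ k) ∣w∣≡1+∣A∣) (ℕₚ.+-suc k ∣ A ∣))) gap

merge-wide : ∀ {k} {w : Subset n} → A ⊂ B → B ⊂ C → ∣ w ∣ ≡ suc ∣ A ∣ →
             Wide k A B ⊎ Wide k B C → Wide k w C
merge-wide {A = A} {B} {C} {k} A⊂B B⊂C ∣w∣≡1+∣A∣ wide =
  subst (λ s → k + s ≤ ∣ C ∣) (sym ∣w∣≡1+∣A∣) (Sum.[ from-below , from-above ] wide)
  where
  open ≤-Reasoning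
  from-below : Wide k A B → k + suc ∣ A ∣ ≤ ∣ C ∣
  from-below AB = begin
    k + suc ∣ A ∣   ≡⟨ ℕₚ.+-suc k ∣ A ∣ ⟩
    suc (k + ∣ A ∣) ≤⟨ s≤s AB ⟩
    suc ∣ B ∣       ≤⟨ p⊂q⇒∣p∣<∣q∣ B⊂C ⟩
    ∣ C ∣           ∎
  from-above : Wide k B C → k + suc ∣ A ∣ ≤ ∣ C ∣
  from-above BC = ℕₚ.≤-trans (ℕₚ.+-monoʳ-≤ k (p⊂q⇒∣p∣<∣q∣ A⊂B)) BC

chain-size : ∀ {n} {x : Subset n} xs {y} → Linked _⊂_ (x ∷ xs ∷ʳ y) → length xs + ∣ x ∣ < ∣ y ∣
chain-size [] (x⊂y ∷ [-]) = p⊂q⇒∣p∣<∣q∣ x⊂y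
chain-size {x = x} (x′ ∷ xs) {y} (x⊂x′ ∷ l) = begin-strict
  suc (length xs + ∣ x ∣) ≡⟨ ℕₚ.+-suc (length xs) ∣ x ∣ ⟨
  length xs + suc ∣ x ∣   ≤⟨ ℕₚ.+-monoʳ-≤ (length xs) (p⊂q⇒∣p∣<∣q∣ x⊂x′) ⟩
  length xs + ∣ x′ ∣      <⟨ chain-size xs l ⟩
  ∣ y ∣                   ∎
  where open ≤-Reasoning

chain-size-wide : ∀ {n k} {x : Subset n} xs {y} →
  Linked _⊂_ (x ∷ xs ∷ʳ y) → AnyAdj (Wide k) (x ∷ xs ∷ʳ y) → length xs + k + ∣ x ∣ ≤ ∣ y ∣
chain-size-wide [] _ (here wide) = wide
chain-size-wide [] _ (there (there ()))
chain-size-wide {k = k} {x} (x′ ∷ xs) {y} (x⊂x′ ∷ l) (here wide) = begin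
  suc (length xs + k + ∣ x ∣)   ≡⟨ cong suc (ℕₚ.+-assoc (length xs) k ∣ x ∣) ⟩
  suc (length xs + (k + ∣ x ∣)) ≤⟨ s≤s (ℕₚ.+-monoʳ-≤ (length xs) wide) ⟩
  suc (length xs + ∣ x′ ∣)      ≤⟨ chain-size xs l ⟩
  ∣ y ∣                         ∎
  where open ≤-Reasoning
chain-size-wide {k = k} {x} (x′ ∷ xs) {y} (x⊂x′ ∷ l) (there a) = begin
  suc (length xs + k + ∣ x ∣) ≡⟨ ℕₚ.+-suc (length xs + k) ∣ x ∣ ⟨
  length xs + k + suc ∣ x ∣   ≤⟨ ℕₚ.+-monoʳ-≤ (length xs + k) (p⊂q⇒∣p∣<∣q∣ x⊂x′) ⟩
  length xs + k + ∣ x′ ∣      ≤⟨ chain-size-wide xs l a ⟩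
  ∣ y ∣                       ∎
  where open ≤-Reasoning

wide-span : ∀ {k} {x : Subset n} xs {y} →
  Linked _⊂_ (x ∷ xs ∷ʳ y) → AnyAdj (Wide k) (x ∷ xs ∷ʳ y) → Wide k x y
wide-span xs {y} l a = ℕₚ.≤-trans (ℕₚ.m≤n+m _ (length xs))
  (subst (_≤ ∣ y ∣) (ℕₚ.+-assoc (length xs) _ _) (chain-size-wide xs l a))

refine-chain : ∀ {n} {x : Subset n} xs {y} → Linked _⊂_ (x ∷ xs ∷ʳ y) → suc (length xs + ∣ x ∣) < ∣ y ∣ →
               ∃ λ xs′ → xs ⊑ xs′ × length xs′ ≡ suc (length xs) × Linked _⊂_ (x ∷ xs′ ∷ʳ y)
refine-chain [] (x⊂y ∷ [-]) gap with split-step x⊂y gap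
... | w , x⊂w , w⊂y , _ = w ∷ [] , skip w [] , refl , x⊂w ∷ w⊂y ∷ [-]
refine-chain {x = x} (x′ ∷ xs) (x⊂x′ ∷ l) gap with suc ∣ x ∣ <? ∣ x′ ∣
... | yes big with split-step x⊂x′ big
...   | w , x⊂w , w⊂x′ , _ = w ∷ x′ ∷ xs , skip w ⊑-refl , refl , x⊂w ∷ w⊂x′ ∷ l
refine-chain {x = x} (x′ ∷ xs) {y} (x⊂x′ ∷ l) gap | no small with refine-chain xs l gap′
  where
  open ≤-Reasoning
  gap′ : suc (length xs + ∣ x′ ∣) < ∣ y ∣
  gap′ = begin-strict
    suc (length xs + ∣ x′ ∣)       ≤⟨ s≤s (ℕₚ.+-monoʳ-≤ (length xs) (ℕₚ.≮⇒≥ small)) ⟩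
    suc (length xs + suc ∣ x ∣)    ≡⟨ cong suc (ℕₚ.+-suc (length xs) ∣ x ∣) ⟩
    suc (suc (length xs + ∣ x ∣))  <⟨ gap ⟩
    ∣ y ∣                          ∎
... | xs′ , xs⊑xs′ , len , l′ = x′ ∷ xs′ , refl ∷ xs⊑xs′ , cong suc len , x⊂x′ ∷ l′

refine-wide-chain : ∀ {n k} → 1 ≤ k → ∀ {x : Subset n} xs {y} →
  Linked _⊂_ (x ∷ xs ∷ʳ y) → AnyAdj (Wide k) (x ∷ xs ∷ʳ y) → length xs + k + ∣ x ∣ < ∣ y ∣ →
  ∃ λ xs′ → xs ⊑ xs′ × length xs′ ≡ suc (length xs) ×
            Linked _⊂_ (x ∷ xs′ ∷ʳ y) × AnyAdj (Wide k) (x ∷ xs′ ∷ʳ y)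
refine-wide-chain 1≤k [] (x⊂y ∷ [-]) _ gap with split-wide-step 1≤k x⊂y gap
... | w , x⊂w , w⊂y , wide = w ∷ [] , skip w [] , refl , x⊂w ∷ w⊂y ∷ [-] , there (here wide)
refine-wide-chain {k = k} 1≤k {x} (x′ ∷ xs) {y} (x⊂x′ ∷ l) (here wide) gap with k + ∣ x ∣ <? ∣ x′ ∣
... | yes big with split-wide-step 1≤k x⊂x′ big
...   | w , x⊂w , w⊂x′ , wide′ = w ∷ x′ ∷ xs , skip w ⊑-refl , refl , x⊂w ∷ w⊂x′ ∷ l , there (here wide′)
refine-wide-chain {k = k} 1≤k {x} (x′ ∷ xs) {y} (x⊂x′ ∷ l) (here wide) gap | no small
  with refine-chain xs l gap′
  where
  open ≤-Reasoning
  gap′ : suc (length xs + ∣ x′ ∣) < ∣ y ∣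
  gap′ = begin-strict
    suc (length xs + ∣ x′ ∣)      ≤⟨ s≤s (ℕₚ.+-monoʳ-≤ (length xs) (ℕₚ.≮⇒≥ small)) ⟩
    suc (length xs + (k + ∣ x ∣)) ≡⟨ cong suc (ℕₚ.+-assoc (length xs) k ∣ x ∣) ⟨
    suc (length xs + k + ∣ x ∣)   <⟨ gap ⟩
    ∣ y ∣                         ∎
... | xs′ , xs⊑xs′ , len , l′ = x′ ∷ xs′ , refl ∷ xs⊑xs′ , cong suc len , x⊂x′ ∷ l′ , here wide
refine-wide-chain {k = k} 1≤k {x} (x′ ∷ xs) {y} (x⊂x′ ∷ l) (there a) gap
  with length xs + k + ∣ x′ ∣ <? ∣ y ∣
... | yes room with refine-wide-chain 1≤k xs l a room
...   | xs′ , xs⊑xs′ , len , l′ , a′ = x′ ∷ xs′ , refl ∷ xs⊑xs′ , cong suc len , x⊂x′ ∷ l′ , there a′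
refine-wide-chain {k = k} 1≤k {x} (x′ ∷ xs) {y} (x⊂x′ ∷ l) (there a) gap | no full
  with split-step x⊂x′ (ℕₚ.+-cancelˡ-≤ (length xs + k) _ _ big)
  where
  open ≤-Reasoning
  big : length xs + k + suc (suc ∣ x ∣) ≤ length xs + k + ∣ x′ ∣
  big = begin
    length xs + k + suc (suc ∣ x ∣) ≡⟨ trans (ℕₚ.+-suc _ _) (cong suc (ℕₚ.+-suc _ _)) ⟩
    suc (suc (length xs + k + ∣ x ∣)) ≤⟨ ℕₚ.<-≤-trans gap (ℕₚ.≮⇒≥ full) ⟩
    length xs + k + ∣ x′ ∣            ∎
... | w , x⊂w , w⊂x′ , _ = w ∷ x′ ∷ xs , skip w ⊑-refl , refl , x⊂w ∷ w⊂x′ ∷ l , there (there a)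

-- The coloring complex of the complete k-uniform hypergraph

WideFace : ℕ → Complex n
WideFace k G = Linked _⊂_ (augment G) × AnyAdj (Wide k) (augment G)

hyperedge⇒wide : ∀ {k} → A ⊆ B → BlockHasEdge (Complete n k) A B → Wide k A B
hyperedge⇒wide {A = A} {B} {k} A⊆B (e , ∣e∣≡k , e⊆B─A) = begin
  k + ∣ A ∣     ≡⟨ cong (_+ ∣ A ∣) ∣e∣≡k ⟨
  ∣ e ∣ + ∣ A ∣ ≤⟨ ℕₚ.+-monoˡ-≤ ∣ A ∣ (p⊆q⇒∣p∣≤∣q∣ e⊆B─A) ⟩
  ∣ B ─ A ∣ + ∣ A ∣ ≡⟨ ∣p─q∣+∣q∣≡∣p∣ A⊆B ⟩
  ∣ B ∣         ∎
  where open ≤-Reasoning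

wide⇒hyperedge : ∀ {k} → A ⊆ B → Wide k A B → BlockHasEdge (Complete n k) A B
wide⇒hyperedge {A = A} {B} {k} A⊆B wide with ∃-⊆-of-size k k≤∣B─A∣
  where
  k≤∣B─A∣ : k ≤ ∣ B ─ A ∣
  k≤∣B─A∣ = ℕₚ.+-cancelʳ-≤ ∣ A ∣ k _ (subst (k + ∣ A ∣ ≤_) (sym (∣p─q∣+∣q∣≡∣p∣ A⊆B)) wide)
... | e , e⊆B─A , ∣e∣≡k = e , ∣e∣≡k , e⊆B─A

Λ-Complete⇔WideFace : ∀ {k} (G : List (Subset n)) → Λ (Complete n k) G ⇔ WideFace k G
Λ-Complete⇔WideFace G = mk⇔
  (λ (l , a) → l , AnyAdj-map-Linked (λ A⊂B → hyperedge⇒wide (p⊂q⇒p⊆q A⊂B)) l a)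
  (λ (l , a) → l , AnyAdj-map-Linked (λ A⊂B → wide⇒hyperedge (p⊂q⇒p⊆q A⊂B)) l a)

module _ {n k : ℕ} where

  WideFace-length : ∀ {G : List (Subset n)} → WideFace k G → length G + k ≤ n
  WideFace-length {G} (l , a) = subst₂ _≤_ (ℕₚ.+-identityʳ _) (∣⊤∣≡n n)
    (subst (λ s → length G + k + s ≤ ∣ ⊤ {n} ∣) (∣⊥∣≡0 n) (chain-size-wide G l a))

  WideFace-refine : 1 ≤ k → ∀ {G : List (Subset n)} → WideFace k G → length G + k < n →
                    ∃ λ G′ → WideFace k G′ × G ⊑ G′ × length G′ ≡ suc (length G)
  WideFace-refine 1≤k {G} (l , a) gap with refine-wide-chain 1≤k G l a gap′
    where
    gap′ : length G + k + ∣ ⊥ {n} ∣ < ∣ ⊤ {n} ∣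
    gap′ = subst₂ _<_ (trans (sym (ℕₚ.+-identityʳ _)) (cong (_+_ (length G + k)) (sym (∣⊥∣≡0 n))))
                      (sym (∣⊤∣≡n n)) gap
  ... | G′ , G⊑G′ , len , l′ , a′ = G′ , (l′ , a′) , G⊑G′ , len

  augment-++ : ∀ (P : List (Subset n)) T R → augment (P ++ T ∷ R) ≡ (⊥ ∷ P) ++ T ∷ R ∷ʳ ⊤
  augment-++ P T R = cong (⊥ ∷_) (Listₚ.++-assoc P (T ∷ R) [ ⊤ ])

  WideFace-split : ∀ (P : List (Subset n)) {T R} → WideFace k (P ++ T ∷ R) →
    Linked _⊂_ (⊥ ∷ P ∷ʳ T) × Linked _⊂_ (T ∷ R ∷ʳ ⊤) ×
    (AnyAdj (Wide k) (⊥ ∷ P ∷ʳ T) ⊎ AnyAdj (Wide k) (T ∷ R ∷ʳ ⊤))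
  WideFace-split P {T} {R} (l , a) rewrite augment-++ P T R with Linked-++⁻ (⊥ ∷ P) l
  ... | l₁ , l₂ = l₁ , l₂ , AnyAdj-++⁻ (⊥ ∷ P) a

  WideFace-join : ∀ (P : List (Subset n)) {T R} → Linked _⊂_ (⊥ ∷ P ∷ʳ T) → Linked _⊂_ (T ∷ R ∷ʳ ⊤) →
    AnyAdj (Wide k) (⊥ ∷ P ∷ʳ T) ⊎ AnyAdj (Wide k) (T ∷ R ∷ʳ ⊤) → WideFace k (P ++ T ∷ R)
  WideFace-join P {T} {R} l₁ l₂ a rewrite augment-++ P T R =
    Linked-++⁺ (⊥ ∷ P) l₁ l₂ , Sum.[ AnyAdj-++⁺ˡ (⊥ ∷ P) , AnyAdj-++⁺ʳ (⊥ ∷ P) ] a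

  -- Two wide steps on either side of T would need 2k ≤ n points.
  WideFace-splice : n < k + k → ∀ (P : List (Subset n)) {T R} P′ {R′} →
    WideFace k (P ++ T ∷ R) → WideFace k (P′ ++ T ∷ R′) → WideFace k (P′ ++ T ∷ R)
  WideFace-splice n<2k P {T} {R} P′ {R′} F F′ with WideFace-split P F | WideFace-split P′ F′
  ... | _ , l₂ , a | l₁′ , _ , inj₁ a₁′ = WideFace-join P′ l₁′ l₂ (inj₁ a₁′)
  ... | _ , l₂ , inj₂ a₂ | l₁′ , _ , _ = WideFace-join P′ l₁′ l₂ (inj₂ a₂)
  ... | l₁ , _ , inj₁ a₁ | _ , l₂′ , inj₂ a₂′ = contradiction n<2k (ℕₚ.≤⇒≯ (begin
    k + k       ≡⟨ cong (_+_ k) (ℕₚ.+-identityʳ k) ⟨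
    k + (k + 0) ≤⟨ ℕₚ.+-monoʳ-≤ k (subst (λ s → k + s ≤ ∣ T ∣) (∣⊥∣≡0 n) (wide-span P l₁ a₁)) ⟩
    k + ∣ T ∣   ≤⟨ wide-span R′ l₂′ a₂′ ⟩
    ∣ ⊤ {n} ∣     ≡⟨ ∣⊤∣≡n n ⟩
    n         ∎))
    where open ≤-Reasoning

  WideFace-neighbours : ∀ (P : List (Subset n)) {B R} →
    WideFace k (P ++ B ∷ R) → lastOr ⊥ P ⊂ B × B ⊂ headOr ⊤ R
  WideFace-neighbours P {B} {R} (l , _) with neighbours ⊥ P R ⊤
  ... | L , _ , eq = Linked-neighbours L (subst (Linked _⊂_) (eq B) l)

  WideFace-replace : ∀ (P : List (Subset n)) {B R w} → WideFace k (P ++ B ∷ R) →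
    lastOr ⊥ P ⊂ w → w ⊂ headOr ⊤ R → ∣ w ∣ ≡ suc ∣ lastOr ⊥ P ∣ → WideFace k (P ++ w ∷ R)
  WideFace-replace P {B} {R} {w} F@(l , a) A⊂w w⊂C ∣w∣≡1+∣A∣ with neighbours ⊥ P R ⊤
  ... | L , _ , eq with WideFace-neighbours P F
  ...   | A⊂B , B⊂C =
    subst (Linked _⊂_) (sym (eq w)) (Linked-replace L (subst (Linked _⊂_) (eq B) l) A⊂w w⊂C) ,
    subst (AnyAdj (Wide k)) (sym (eq w))
      (AnyAdj-replace L (subst (AnyAdj (Wide k)) (eq B) a) (merge-wide {w = w} A⊂B B⊂C ∣w∣≡1+∣A∣))

-- Lexicographic orders

infix 4 _≺_ _≺?_

data _≺_ : Subset n → Subset n → Set where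
  this : ∀ {p q : Subset n} → (outside ∷ p) ≺ (inside ∷ q)
  next : ∀ {s} {p q : Subset n} → p ≺ q → (s ∷ p) ≺ (s ∷ q)

≺-irrefl : ¬ p ≺ p
≺-irrefl (next p≺p) = ≺-irrefl p≺p

≺-asym : p ≺ q → ¬ q ≺ p
≺-asym (next p≺q) (next q≺p) = ≺-asym p≺q q≺p

_≺?_ : ∀ (p q : Subset n) → Dec (p ≺ q)
[] ≺? [] = no λ ()
(outside ∷ p) ≺? (inside ∷ q) = yes this
(inside ∷ p) ≺? (outside ∷ q) = no λ ()
(outside ∷ p) ≺? (outside ∷ q) = map′ next (λ { (next p≺q) → p≺q }) (p ≺? q)
(inside ∷ p) ≺? (inside ∷ q) = map′ next (λ { (next p≺q) → p≺q }) (p ≺? q)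

⊂⇒≺ : ∀ {n} {p q : Subset n} → p ⊂ q → p ≺ q
⊂⇒≺ {p = []} {[]} (_ , () , _)
⊂⇒≺ {p = outside ∷ p} {inside ∷ q} _ = this
⊂⇒≺ {p = inside ∷ p} {outside ∷ q} (p⊆q , _) = contradiction (p⊆q here) λ ()
⊂⇒≺ {p = outside ∷ p} {outside ∷ q} p⊂q = next (⊂⇒≺ (drop-∷-⊂ p⊂q))
⊂⇒≺ {p = inside ∷ p} {inside ∷ q} p⊂q = next (⊂⇒≺ (drop-∷-⊂ p⊂q))

≺⇒first-difference : p ≺ q → ∃ λ a → a ∉ p × a ∈ q × (∀ {y} → y Fin.< a → y ∈ p → y ∈ q)
≺⇒first-difference this = zero , (λ ()) , here , λ ()
≺⇒first-difference (next {s = s} p≺q) with ≺⇒first-difference p≺q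
... | a , a∉p , a∈q , agree = suc a , a∉p ∘ drop-there , there a∈q , agree′
  where
  agree′ : ∀ {y} → y Fin.< suc a → y ∈ s ∷ _ → y ∈ s ∷ _
  agree′ {zero} _ here = here
  agree′ {suc y} (s≤s y<a) (there y∈p) = there (agree y<a y∈p)

adjoin-≺ : ∀ {n} {A : Subset n} {x z} → x ∉ A → z ∉ A → x Fin.< z → A ∪ ⁅ z ⁆ ≺ A ∪ ⁅ x ⁆
adjoin-≺ {A = outside ∷ A} {zero} {suc z} _ _ _ = this
adjoin-≺ {A = inside ∷ A} {zero} x∉A _ _ = contradiction here x∉A
adjoin-≺ {A = s ∷ A} {suc x} {suc z} x∉A z∉A (s≤s x<z) = next (adjoin-≺ (x∉A ∘ there) (z∉A ∘ there) x<z)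

infix 4 _<ᴸ_

data _<ᴸ_ : List (Subset n) → List (Subset n) → Set where
  this : ∀ {S T} {F G : List (Subset n)} → S ≺ T → (S ∷ F) <ᴸ (T ∷ G)
  next : ∀ {S} {F G : List (Subset n)} → F <ᴸ G → (S ∷ F) <ᴸ (S ∷ G)

<ᴸ-irrefl : ∀ {F : List (Subset n)} → ¬ F <ᴸ F
<ᴸ-irrefl (this S≺S) = ≺-irrefl S≺S
<ᴸ-irrefl (next F<F) = <ᴸ-irrefl F<F

<ᴸ-asym : ∀ {F G : List (Subset n)} → F <ᴸ G → ¬ G <ᴸ F
<ᴸ-asym (this S≺T) (this T≺S) = ≺-asym S≺T T≺S
<ᴸ-asym (this S≺S) (next _) = ≺-irrefl S≺S
<ᴸ-asym (next _) (this S≺S) = ≺-irrefl S≺S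
<ᴸ-asym (next F<G) (next G<F) = <ᴸ-asym F<G G<F

<ᴸ-split : ∀ {F′ F : List (Subset n)} → F′ <ᴸ F →
  ∃ λ P → ∃₂ λ T T′ → ∃₂ λ R R′ → F ≡ P ++ T ∷ R × F′ ≡ P ++ T′ ∷ R′ × T′ ≺ T
<ᴸ-split (this T′≺T) = [] , _ , _ , _ , _ , refl , refl , T′≺T
<ᴸ-split (next {S = S} F′<F) with <ᴸ-split F′<F
... | P , T , T′ , R , R′ , refl , refl , T′≺T = S ∷ P , T , T′ , R , R′ , refl , refl , T′≺T

<ᴸ-++ : ∀ (P : List (Subset n)) {w B R} → w ≺ B → P ++ w ∷ R <ᴸ P ++ B ∷ R
<ᴸ-++ [] w≺B = this w≺B
<ᴸ-++ (S ∷ P) w≺B = next (<ᴸ-++ P w≺B)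

subsets : ∀ n → List (Subset n)
subsets zero = [ [] ]
subsets (suc n) = cartesianProductWith Vec._∷_ (outside ∷ inside ∷ []) (subsets n)

subsets-sorted : ∀ n → AllPairs _≺_ (subsets n)
subsets-sorted zero = [] ∷ []
subsets-sorted (suc n) = AllPairs-cartesianProductWith {R = _<ᴮ_} Vec._∷_ (λ { f<t → this }) next
  {xs = outside ∷ inside ∷ []} ((f<t ∷ []) ∷ [] ∷ []) (subsets-sorted n)

subsets-complete : ∀ (p : Subset n) → p ∈ₗ subsets n
subsets-complete [] = here refl
subsets-complete (outside ∷ p) =
  ∈-cartesianProductWith⁺ Vec._∷_ {outside ∷ inside ∷ []} (here refl) (subsets-complete p)
subsets-complete (inside ∷ p) =
  ∈-cartesianProductWith⁺ Vec._∷_ {outside ∷ inside ∷ []} (there (here refl)) (subsets-complete p)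

lists : ℕ → List (List (Subset n))
lists zero = [ [] ]
lists (suc j) = cartesianProductWith List._∷_ (subsets _) (lists j)

lists-sorted : ∀ j → AllPairs _<ᴸ_ (lists {n} j)
lists-sorted zero = [] ∷ []
lists-sorted {n} (suc j) =
  AllPairs-cartesianProductWith List._∷_ this next (subsets-sorted n) (lists-sorted j)

lists-complete : ∀ {j} (F : List (Subset n)) → length F ≡ j → F ∈ₗ lists j
lists-complete [] refl = here refl
lists-complete (S ∷ F) refl =
  ∈-cartesianProductWith⁺ List._∷_ (subsets-complete S) (lists-complete F refl)

-- Descents

-- Replacing B by A ∪ ⁅ z ⁆ between A and C moves the chain down in the lexicographic order.
Descent : Subset n → Subset n → Subset n → Set
Descent A B C = ∃ λ z → z ∈ C × z ∉ A × A ∪ ⁅ z ⁆ ≺ B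

descent? : ∀ (A B C : Subset n) → Dec (Descent A B C)
descent? A B C = Finₚ.any? λ z → z ∈? C ×-dec ¬? (z ∈? A) ×-dec (A ∪ ⁅ z ⁆ ≺? B)

no-descent : A ⊂ B → B ⊆ C → ¬ Descent A B C →
  ∃ λ x → x ∈ B × x ∉ A × (∀ {y} → y ∈ B → y ∉ A → y ≡ x) × (∀ {z} → z ∈ C → z ∉ B → z Fin.< x)
no-descent {A = A} {B} {C} (A⊆B , x , x∈B , x∉A) B⊆C ¬d = x , x∈B , x∉A , unique , below
  where
  unique : ∀ {y} → y ∈ B → y ∉ A → y ≡ x
  unique {y} y∈B y∉A with y Finₚ.≟ x
  ... | yes y≡x = y≡x
  ... | no y≢x = contradiction
    (y , B⊆C y∈B , y∉A , ⊂⇒≺ (p∪⁅x⁆⊆q A⊆B y∈B , x , x∈B , x∉p∪⁅y⁆ x∉A (y≢x ∘ sym))) ¬d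
  B≡A∪⁅x⁆ : B ≡ A ∪ ⁅ x ⁆
  B≡A∪⁅x⁆ = ⊆-antisym B⊆A∪⁅x⁆ (p∪⁅x⁆⊆q A⊆B x∈B)
    where
    B⊆A∪⁅x⁆ : B ⊆ A ∪ ⁅ x ⁆
    B⊆A∪⁅x⁆ {y} y∈B with y ∈? A
    ... | yes y∈A = x∈p∪q⁺ (inj₁ y∈A)
    ... | no y∉A = x∈p∪q⁺ (inj₂ (subst (_∈ ⁅ x ⁆) (sym (unique y∈B y∉A)) (x∈⁅x⁆ x)))
  below : ∀ {z} → z ∈ C → z ∉ B → z Fin.< x
  below {z} z∈C z∉B with Finₚ.<-cmp z x
  ... | tri< z<x _ _ = z<x
  ... | tri≈ _ refl _ = contradiction x∈B z∉B
  ... | tri> _ _ x<z = contradiction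
    (z , z∈C , z∉B ∘ A⊆B , subst (A ∪ ⁅ z ⁆ ≺_) (sym B≡A∪⁅x⁆) (adjoin-≺ x∉A (z∉B ∘ A⊆B) x<z)) ¬d

no-descent-step : A ⊂ B → B ⊂ C → ¬ Descent A B C → y ∉ B → (∀ {z} → z ∈ B → z ∉ A → z Fin.< y) →
                  y ∉ C × (∀ {z} → z ∈ C → z ∉ B → z Fin.< y)
no-descent-step A⊂B B⊂C ¬d y∉B below with no-descent A⊂B (p⊂q⇒p⊆q B⊂C) ¬d
... | x , x∈B , x∉A , _ , below-x =
  (λ y∈C → Finₚ.<-asym (below-x y∈C y∉B) (below x∈B x∉A)) ,
  λ z∈C z∉B → Finₚ.<-trans (below-x z∈C z∉B) (below x∈B x∉A)

-- Walking up the chain from B, the element y stays outside, so the walk must stop at a descent before ⊤.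
descent-above : ∀ {A B : Subset n} R {y} → Linked _⊂_ (A ∷ B ∷ R ∷ʳ ⊤) → y ∉ B →
  (∀ {z} → z ∈ B → z ∉ A → z Fin.< y) →
  ∃ λ Q → ∃₂ λ B′ R′ → B ∷ R ≡ Q ++ B′ ∷ R′ × B ⊆ B′ × y ∉ B′ × Descent (lastOr A Q) B′ (headOr ⊤ R′)
descent-above {A = A} {B} [] (A⊂B ∷ B⊂⊤ ∷ [-]) y∉B below with descent? A B ⊤
... | yes d = [] , B , [] , refl , ⊆-refl , y∉B , d
... | no ¬d = contradiction ∈⊤ (proj₁ (no-descent-step A⊂B B⊂⊤ ¬d y∉B below))
descent-above {A = A} {B} (C ∷ R) (A⊂B ∷ l@(B⊂C ∷ _)) y∉B below with descent? A B C
... | yes d = [] , B , C ∷ R , refl , ⊆-refl , y∉B , d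
... | no ¬d with no-descent-step A⊂B B⊂C ¬d y∉B below
...   | y∉C , below′ with descent-above R l y∉C below′
...     | Q , B′ , R′ , eq , C⊆B′ , y∉B′ , d =
  B ∷ Q , B′ , R′ , cong (B ∷_) eq , ⊆-trans (p⊂q⇒p⊆q B⊂C) C⊆B′ , y∉B′ , d

module _ {n k : ℕ} where

  descent-replace : ∀ (P : List (Subset n)) {B R} →
    WideFace k (P ++ B ∷ R) → Descent (lastOr ⊥ P) B (headOr ⊤ R) → ∃ λ w → w ≺ B × WideFace k (P ++ w ∷ R)
  descent-replace P F (z , z∈C , z∉A , w≺B) with WideFace-neighbours P F
  ... | A⊂B , B⊂C with adjoin-⊂ (⊆-trans (p⊂q⇒p⊆q A⊂B) (p⊂q⇒p⊆q B⊂C)) z∈C z∉A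
                         (ℕₚ.≤-trans (s≤s (p⊂q⇒∣p∣<∣q∣ A⊂B)) (p⊂q⇒∣p∣<∣q∣ B⊂C))
  ...   | A⊂w , w⊂C = _ , w≺B , WideFace-replace P F A⊂w w⊂C (∣p∪⁅x⁆∣≡1+∣p∣ z∉A)

DescentVertex : List (Subset n) → List (Subset n) → Set
DescentVertex F F′ = ∃ λ P → ∃₂ λ B R → F ≡ P ++ B ∷ R × B ∉ₗ F′ × Descent (lastOr ⊥ P) B (headOr ⊤ R)

module Exchange {n k : ℕ} (n<2k : n < k + k) (P : List (Subset n)) {T T′ R R′}
  (F : WideFace k (P ++ T ∷ R)) (full : length (P ++ T ∷ R) + k ≡ n)
  (F′ : WideFace k (P ++ T′ ∷ R′)) (T′≺T : T′ ≺ T) where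

  private
    T⁻ T⁺ : Subset n
    T⁻ = lastOr ⊥ P
    T⁺ = headOr ⊤ R

    T⁻⊂T : T⁻ ⊂ T
    T⁻⊂T = proj₁ (WideFace-neighbours P F)

    T⊂T⁺ : T ⊂ T⁺
    T⊂T⁺ = proj₂ (WideFace-neighbours P F)

    T⁻⊂T′ : T⁻ ⊂ T′
    T⁻⊂T′ = proj₁ (WideFace-neighbours P F′)

    a : Fin n
    a = proj₁ (≺⇒first-difference T′≺T)

    a∉T′ : a ∉ T′
    a∉T′ = proj₁ (proj₂ (≺⇒first-difference T′≺T))

    a∈T : a ∈ T
    a∈T = proj₁ (proj₂ (proj₂ (≺⇒first-difference T′≺T)))

    agree-below-a : ∀ {y} → y Fin.< a → y ∈ T′ → y ∈ T
    agree-below-a = proj₂ (proj₂ (proj₂ (≺⇒first-difference T′≺T)))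

    a∉T⁻ : a ∉ T⁻
    a∉T⁻ = a∉T′ ∘ p⊂q⇒p⊆q T⁻⊂T′

    below-T : ∀ {B} → B ∈ₗ P → B ⊂ T
    below-T B∈P = ∈-init-Linked ⊂-trans (⊥ ∷ P) (proj₁ (WideFace-split P F)) (there B∈P)

    above-T′ : ∀ {B} → B ∈ₗ R′ → T′ ⊂ B
    above-T′ B∈R′ = ∈-tail-Linked ⊂-trans (proj₁ (proj₂ (WideFace-split P F′))) (∈-++⁺ˡ B∈R′)

    ∉F′ : ∀ {B y} → T ⊆ B → y ∈ T′ → y ∉ B → B ∉ₗ P ++ T′ ∷ R′
    ∉F′ T⊆B y∈T′ y∉B B∈F′ with ∈-++⁻ P B∈F′
    ... | inj₁ B∈P = ⊂-irref refl (⊂-⊆-trans (below-T B∈P) T⊆B)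
    ... | inj₂ (here refl) = y∉B y∈T′
    ... | inj₂ (there B∈R′) = y∉B (p⊂q⇒p⊆q (above-T′ B∈R′) y∈T′)

    -- If T were a later vertex of F′, splicing F′ below T with F above T would give a face
    -- longer than the facet F.
    T∉F′ : T ∉ₗ P ++ T′ ∷ R′
    T∉F′ T∈F′ with ∈-++⁻ P T∈F′
    ... | inj₁ T∈P = ⊂-irref refl (below-T T∈P)
    ... | inj₂ (here refl) = a∉T′ a∈T
    ... | inj₂ (there T∈R′) with ∈-∃++ T∈R′
    ...   | Q , R″ , refl = ℕₚ.<-irrefl full (begin-strict
      length (P ++ T ∷ R) + k               <⟨ ℕₚ.+-monoˡ-< k longer ⟩
      length ((P ++ T′ ∷ Q) ++ T ∷ R) + k   ≤⟨ WideFace-length spliced ⟩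
      n                                     ∎)
      where
      open ≤-Reasoning
      spliced : WideFace k ((P ++ T′ ∷ Q) ++ T ∷ R)
      spliced = WideFace-splice n<2k P (P ++ T′ ∷ Q) F
        (subst (WideFace k) (sym (Listₚ.++-assoc P (T′ ∷ Q) (T ∷ R″))) F′)
      longer : length (P ++ T ∷ R) < length ((P ++ T′ ∷ Q) ++ T ∷ R)
      longer = begin-strict
        length (P ++ T ∷ R)                        ≡⟨ Listₚ.length-++ P ⟩
        length P + suc (length R)                  <⟨ ℕₚ.+-monoˡ-< (suc (length R)) (ℕₚ.m<m+n _ (s≤s z≤n)) ⟩
        length P + suc (length Q) + suc (length R) ≡⟨ cong (_+ suc (length R)) (Listₚ.length-++ P) ⟨
        length (P ++ T′ ∷ Q) + suc (length R)      ≡⟨ Listₚ.length-++ (P ++ T′ ∷ Q) ⟨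
        length ((P ++ T′ ∷ Q) ++ T ∷ R)            ∎

    descent-at-T : T′ ⊆ T → Descent T⁻ T T⁺
    descent-at-T T′⊆T with T⁻⊂T′
    ... | T⁻⊆T′ , y , y∈T′ , y∉T⁻ = y , p⊂q⇒p⊆q T⊂T⁺ (T′⊆T y∈T′) , y∉T⁻ ,
      ⊂⇒≺ (p∪⁅x⁆⊆q (p⊂q⇒p⊆q T⁻⊂T) (T′⊆T y∈T′) , a , a∈T , x∉p∪⁅y⁆ a∉T⁻ λ { refl → a∉T′ y∈T′ })

    a<y : ∀ {y} → y ∈ T′ → y ∉ T → a Fin.< y
    a<y {y} y∈T′ y∉T with Finₚ.<-cmp a y
    ... | tri< a<y _ _ = a<y
    ... | tri≈ _ refl _ = contradiction y∈T′ a∉T′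
    ... | tri> _ _ y<a = contradiction (agree-below-a y<a y∈T′) y∉T

    descent-above-T : ∀ {y} → y ∈ T′ → y ∉ T → DescentVertex (P ++ T ∷ R) (P ++ T′ ∷ R′)
    descent-above-T {y} y∈T′ y∉T with descent? T⁻ T T⁺
    ... | yes d = P , T , R , refl , ∉F′ ⊆-refl y∈T′ y∉T , d
    ... | no ¬d with no-descent T⁻⊂T (p⊂q⇒p⊆q T⊂T⁺) ¬d
    ...   | _ , _ , _ , only-x , _
      with descent-above R (T⁻⊂T ∷ proj₁ (proj₂ (WideFace-split P F))) y∉T below-y
      where
      below-y : ∀ {z} → z ∈ T → z ∉ T⁻ → z Fin.< y
      below-y z∈T z∉T⁻ =
        subst (Fin._< y) (trans (only-x a∈T a∉T⁻) (sym (only-x z∈T z∉T⁻))) (a<y y∈T′ y∉T)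
    ...     | Q , B , R‴ , eq , T⊆B , y∉B , d =
      P ++ Q , B , R‴ , trans (cong (P ++_) eq) (sym (Listₚ.++-assoc P Q (B ∷ R‴))) ,
      ∉F′ T⊆B y∈T′ y∉B , subst (λ A → Descent A B (headOr ⊤ R‴)) (sym (lastOr-++ ⊥ P Q)) d

  vertex : DescentVertex (P ++ T ∷ R) (P ++ T′ ∷ R′)
  vertex with ⊆⊎⊈ T′ T
  ... | inj₁ T′⊆T = P , T , R , refl , T∉F′ , descent-at-T T′⊆T
  ... | inj₂ (y , y∈T′ , y∉T) = descent-above-T y∈T′ y∉T

exchange : ∀ {n k} → n < k + k → ∀ {F F′ : List (Subset n)} → WideFace k F → length F + k ≡ n →
           WideFace k F′ → F′ <ᴸ F → DescentVertex F F′
exchange n<2k F full F′ F′<F with <ᴸ-split F′<F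
... | P , _ , _ , _ , _ , refl , refl , T′≺T = Exchange.vertex n<2k P F full F′ T′≺T

-- A shelling criterion

dim-delete : ∀ (P : List (Subset n)) B R → dim (P ++ R) ≡ dim (P ++ B ∷ R) - + 1
dim-delete P B R = cong (λ l → + l - + 1 - + 1) (sym (Listₚ.length-++-sucʳ P B R))

dim-< : ∀ {G F : List (Subset n)} → length G < length F → dim G ℤ.≤ dim F - + 1
dim-< {G = G} {F} ∣G∣<∣F∣ with length F | ∣G∣<∣F∣
... | suc l | s≤s ∣G∣≤l = ℤₚ.+-monoˡ-≤ (ℤ.- + 1) (+≤+ ∣G∣≤l)

module ShellingCriterion {n} (K : Complex n) (N : ℕ) (K? : ∀ F → Dec (K F))
  (facet⇔ : ∀ {F} → IsFacet K F ⇔ (K F × length F ≡ N))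
  {_<_ : Rel (List (Subset n)) 0ℓ} (<-irrefl : ∀ {F} → ¬ F < F) (<-asym : ∀ {F G} → F < G → ¬ G < F)
  (candidates : List (List (Subset n))) (sorted : AllPairs _<_ candidates)
  (complete : ∀ {F} → length F ≡ N → F ∈ₗ candidates)
  (exchange : ∀ {F F′} → IsFacet K F → IsFacet K F′ → F′ < F →
     ∃ λ P → ∃₂ λ B R → ∃ λ w → F ≡ P ++ B ∷ R × B ∉ₗ F′ × IsFacet K (P ++ w ∷ R) × (P ++ w ∷ R) < F)
  where

  facet? : ∀ F → Dec (K F × length F ≡ N)
  facet? F = K? F ×-dec length F ℕₚ.≟ N

  facets : List (List (Subset n))
  facets = filter facet? candidates

  facets-sorted : AllPairs _<_ facets
  facets-sorted = AllPairsₚ.filter⁺ facet? sorted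

  ∈facets⇒facet : ∀ {F} → F ∈ₗ facets → IsFacet K F
  ∈facets⇒facet F∈ = Equivalence.from facet⇔ (proj₂ (∈-filter⁻ facet? {xs = candidates} F∈))

  facet⇒∈facets : ∀ {F} → IsFacet K F → F ∈ₗ facets
  facet⇒∈facets facet with Equivalence.to facet⇔ facet
  ... | KF , ∣F∣≡N = ∈-filter⁺ facet? (complete ∣F∣≡N) (KF , ∣F∣≡N)

  module _ (earlier : List (List (Subset n))) {F} post (split : facets ≡ earlier ++ F ∷ post) where

    private
      F-facet : IsFacet K F
      F-facet = ∈facets⇒facet (subst (F ∈ₗ_) (sym split) (∈-++⁺ʳ earlier (here refl)))

      earlier-facet : ∀ {F′} → F′ ∈ₗ earlier → IsFacet K F′
      earlier-facet F′∈ = ∈facets⇒facet (subst (_ ∈ₗ_) (sym split) (∈-++⁺ˡ F′∈))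

      ordered : (∀ {F′} → F′ ∈ₗ earlier → F′ < F) × (∀ {F′} → F′ ∈ₗ post → F < F′)
      ordered = AllPairs-++⁻ earlier (subst (AllPairs _<_) split facets-sorted)

      smaller⇒earlier : ∀ {F″} → IsFacet K F″ → F″ < F → F″ ∈ₗ earlier
      smaller⇒earlier {F″} facet F″<F with ∈-++⁻ earlier (subst (F″ ∈ₗ_) split (facet⇒∈facets facet))
      ... | inj₁ F″∈earlier = F″∈earlier
      ... | inj₂ (here refl) = contradiction F″<F <-irrefl
      ... | inj₂ (there F″∈post) = contradiction F″<F (<-asym (proj₂ ordered F″∈post))

    pure : ∀ G → EarlierIntersection earlier F G →
           ∃ λ G′ → EarlierIntersection earlier F G′ × G ⊑ G′ × dim G′ ≡ dim F - + 1
    pure G (G⊑F , F′ , F′∈ , G⊑F′) with exchange F-facet (earlier-facet F′∈) (proj₁ ordered F′∈)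
    ... | P , B , R , w , refl , B∉F′ , F″-facet , F″<F =
      P ++ R , (⊑-delete P , _ , smaller⇒earlier F″-facet F″<F , ⊑-delete P) ,
      ⊑-avoid P G⊑F (B∉F′ ∘ lookup G⊑F′) , dim-delete P B R

    bounded : ∀ G → EarlierIntersection earlier F G → dim G ℤ.≤ dim F - + 1
    bounded G (G⊑F , F′ , F′∈ , G⊑F′) with length F ℕₚ.≤? length G
    ... | no ∣F∣≰∣G∣ = dim-< {G = G} {F} (ℕₚ.≰⇒> ∣F∣≰∣G∣)
    ... | yes ∣F∣≤∣G∣ with ⊑∧length≥⇒≡ G⊑F ∣F∣≤∣G∣
    ...   | refl = contradiction (subst (_< G) F′≡G (proj₁ ordered F′∈)) <-irrefl
      where
      F′≡G : F′ ≡ G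
      F′≡G = proj₂ F-facet F′ (proj₁ (earlier-facet F′∈)) G⊑F′

  shellable : Shellable K
  shellable = facets ,
    All.tabulate ∈facets⇒facet ,
    AllPairs.map (λ F<G F≡G → <-irrefl (subst (_< _) F≡G F<G)) facets-sorted ,
    (λ _ → facet⇒∈facets) ,
    λ pre post F F₀ split → pure (F₀ ∷ pre) post split , bounded (F₀ ∷ pre) post split

IsFacet-resp : (∀ G → K G ⇔ K′ G) → ∀ {F} → IsFacet K F → IsFacet K′ F
IsFacet-resp K⇔K′ (KF , maximal) =
  Equivalence.to (K⇔K′ _) KF , λ G K′G F⊑G → maximal G (Equivalence.from (K⇔K′ G) K′G) F⊑G

Shellable-resp : (∀ G → K G ⇔ K′ G) → Shellable K → Shellable K′
Shellable-resp K⇔K′ (Fs , facets , unique , complete , shelling) =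
  Fs , All.map (IsFacet-resp K⇔K′) facets , unique ,
  (λ F F-facet → complete F (IsFacet-resp (⇔.sym ∘ K⇔K′) F-facet)) , shelling

HasDimension-resp : ∀ {d} → (∀ G → K G ⇔ K′ G) → HasDimension K d → HasDimension K′ d
HasDimension-resp K⇔K′ ((G , KG , dimG) , bounded) =
  (G , Equivalence.to (K⇔K′ G) KG , dimG) , λ G K′G → bounded G (Equivalence.from (K⇔K′ G) K′G)

module _ {n k : ℕ} (1≤k : 1 ≤ k) (k≤n : k ≤ n) where

  WideFace? : ∀ G → Dec (WideFace {n} k G)
  WideFace? G = linked? _⊂?_ (augment G) ×-dec anyAdj? (λ A B → k + ∣ A ∣ ≤? ∣ B ∣) (augment G)

  facet⇒full : ∀ {F : List (Subset n)} → IsFacet (WideFace k) F → length F + k ≡ n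
  facet⇒full {F} (face , maximal) = ℕₚ.≤-antisym (WideFace-length face) (ℕₚ.≮⇒≥ not-refinable)
    where
    not-refinable : ¬ length F + k < n
    not-refinable gap with WideFace-refine 1≤k face gap
    ... | G′ , face′ , F⊑G′ , ∣G′∣≡1+∣F∣ =
      ℕₚ.1+n≢n (trans (sym ∣G′∣≡1+∣F∣) (cong length (maximal G′ face′ F⊑G′)))

  full⇒facet : ∀ {F : List (Subset n)} → WideFace k F → length F + k ≡ n → IsFacet (WideFace k) F
  full⇒facet face full = face , λ G face′ F⊑G → sym (⊑∧length≥⇒≡ F⊑G
    (ℕₚ.+-cancelʳ-≤ k _ _ (ℕₚ.≤-trans (WideFace-length face′) (ℕₚ.≤-reflexive (sym full)))))

  facet⇔ : ∀ {F : List (Subset n)} → IsFacet (WideFace k) F ⇔ (WideFace k F × length F ≡ n ∸ k)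
  facet⇔ = mk⇔
    (λ facet → proj₁ facet , trans (sym (ℕₚ.m+n∸n≡m _ k)) (cong (_∸ k) (facet⇒full facet)))
    (λ (face , ∣F∣≡n∸k) → full⇒facet face (trans (cong (_+ k) ∣F∣≡n∸k) (ℕₚ.m∸n+n≡m k≤n)))

  WideFace-of-length : ∀ j → j + k ≤ n → ∃ λ (G : List (Subset n)) → WideFace k G × length G ≡ j
  WideFace-of-length zero _ = [] , (⊥⊂⊤ ∷ [-] , here wide) , refl
    where
    ⊥⊂⊤ : ⊥ {n} ⊂ ⊤
    ⊥⊂⊤ = p⊆q∧∣p∣<∣q∣⇒p⊂q ⊆⊤ (subst₂ _<_ (sym (∣⊥∣≡0 n)) (sym (∣⊤∣≡n n)) (ℕₚ.≤-trans 1≤k k≤n))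
    wide : Wide k (⊥ {n}) ⊤
    wide = subst₂ (λ a b → k + a ≤ b) (sym (∣⊥∣≡0 n)) (sym (∣⊤∣≡n n))
                  (subst (_≤ n) (sym (ℕₚ.+-identityʳ k)) k≤n)
  WideFace-of-length (suc j) 1+j+k≤n with WideFace-of-length j (ℕₚ.<⇒≤ 1+j+k≤n)
  ... | G , face , ∣G∣≡j with WideFace-refine 1≤k face (subst (λ l → l + k < n) (sym ∣G∣≡j) 1+j+k≤n)
  ...   | G′ , face′ , _ , ∣G′∣≡1+∣G∣ = G′ , face′ , trans ∣G′∣≡1+∣G∣ (cong suc ∣G∣≡j)

  WideFace-dimension : HasDimension (WideFace k) (+ n - + k - + 1)
  WideFace-dimension with WideFace-of-length (n ∸ k) (ℕₚ.≤-reflexive (ℕₚ.m∸n+n≡m k≤n))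
  ... | G , face , ∣G∣≡n∸k =
    (G , face , trans (cong (λ l → + l - + 1) ∣G∣≡n∸k) (cong (_- + 1) +[n∸k]≡n-k)) ,
    λ G′ face′ → subst (λ d → dim G′ ℤ.≤ d - + 1) +[n∸k]≡n-k
      (ℤₚ.+-monoˡ-≤ (ℤ.- + 1) (+≤+ (ℕₚ.m+n≤o⇒m≤o∸n (length G′) (WideFace-length face′))))
    where
    +[n∸k]≡n-k : + (n ∸ k) ≡ + n - + k
    +[n∸k]≡n-k = sym (trans (ℤₚ.m-n≡m⊖n n k) (ℤₚ.⊖-≥ k≤n))

  WideFace-shellable : n < k + k → Shellable (WideFace {n} k)
  WideFace-shellable n<2k = ShellingCriterion.shellable (WideFace k) (n ∸ k) WideFace? facet⇔
    <ᴸ-irrefl <ᴸ-asym (lists (n ∸ k)) (lists-sorted (n ∸ k)) (λ {F} → lists-complete F) exchange′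
    where
    exchange′ : ∀ {F F′} → IsFacet (WideFace k) F → IsFacet (WideFace k) F′ → F′ <ᴸ F →
      ∃ λ P → ∃₂ λ B R → ∃ λ w →
        F ≡ P ++ B ∷ R × B ∉ₗ F′ × IsFacet (WideFace k) (P ++ w ∷ R) × P ++ w ∷ R <ᴸ F
    exchange′ F-facet@(face , _) (face′ , _) F′<F with exchange n<2k face (facet⇒full F-facet) face′ F′<F
    ... | P , B , R , refl , B∉F′ , descent with descent-replace P face descent
    ...   | w , w≺B , face″ = P , B , R , w , refl , B∉F′ , full⇒facet face″ full″ , <ᴸ-++ P w≺B
      where
      full″ : length (P ++ w ∷ R) + k ≡ n
      full″ = trans (cong (_+ k) (trans (Listₚ.length-++-sucʳ P w R) (sym (Listₚ.length-++-sucʳ P B R))))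
                    (facet⇒full F-facet)

theorem3p1 : (n k : ℕ) → 3 ≤ k → n < 2 * k → k ≤ n →
    Shellable (Λ (Complete n k)) × HasDimension (Λ (Complete n k)) (+ n - + k - + 1)
theorem3p1 n k 3≤k n<2k k≤n =
  Shellable-resp WideFace⇔Λ (WideFace-shellable 1≤k k≤n n<k+k) ,
  HasDimension-resp WideFace⇔Λ (WideFace-dimension 1≤k k≤n)
  where
  1≤k : 1 ≤ k
  1≤k = ℕₚ.≤-trans (s≤s z≤n) 3≤k
  n<k+k : n < k + k
  n<k+k = subst (λ m → n < k + m) (ℕₚ.+-identityʳ k) n<2k
  WideFace⇔Λ : ∀ G → WideFace k G ⇔ Λ (Complete n k) G
  WideFace⇔Λ G = ⇔.sym (Λ-Complete⇔WideFace G)
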